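{- Let $G$ be a finite simple graph embedded in a closed surface $\Sigma$ and let $\mathcal F$ be a set of even faces. Let $H$ be a connected component of $R(G;\mathcal F)$ and let $G_H$ be the subgraph of $G$ induced by the faces corresponding to edges of $H$. If a perfect matching $M$ of $G$ is a vertex of $H$, then $M\cap E(G_H)$ is a perfect matching of $G_H$.
   Context: A closed surface is a compact connected 2-dimensional manifold without boundary. A face of $G$ is the closure of a connected component of $\Sigma\setminus G$; $E(f)$ is the set of edges on the boundary of $f$. A face is even if its boundary is a cycle of even length. The resonance graph $R(G;\mathcal F)$ has vertex set the perfect matchings of $G$, with $M_1\sim M_2$ iff $M_1\oplus M_2=E(f)$ for some $f\in\mathcal F$; such an edge corresponds to the face $f$. The subgraph $G_H$ is the union of the boundaries of all faces corresponding to edges of $H$. -}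

module Defs where

open import Data.Nat using (ℕ; zero; suc; _<_; _≤_)
open import Data.Nat.Divisibility using (_∣_)
open import Data.Fin using (Fin)
open import Data.Bool using (Bool; true; false; _xor_)
open import Data.Product using (Σ; ∃; ∃-syntax; _×_; _,_; proj₁; proj₂)
open import Data.Sum using (_⊎_)
open import Data.Unit using (⊤)
open import Relation.Binary.PropositionalEquality using (_≡_; _≢_)
open import Relation.Binary.Construct.Closure.ReflexiveTransitive using (Star)
open import Function.Bundles using (_⇔_)

record Graph : Set where
  field
    n     : ℕ
    m     : ℕ
    ends  : Fin m → Fin n × Fin n
    loopless : ∀ e → proj₁ (ends e) ≢ proj₂ (ends e)
    simple : ∀ e e' →
      ((proj₁ (ends e) ≡ proj₁ (ends e') × proj₂ (ends e) ≡ proj₂ (ends e'))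
       ⊎ (proj₁ (ends e) ≡ proj₂ (ends e') × proj₂ (ends e) ≡ proj₁ (ends e'))) →
      e ≡ e'

module _ (G : Graph) where
  open Graph G

  EdgeSet : Set
  EdgeSet = Fin m → Bool

  Incident : Fin m → Fin n → Set
  Incident e v = proj₁ (ends e) ≡ v ⊎ proj₂ (ends e) ≡ v

  Joins : Fin m → Fin n → Fin n → Set
  Joins e a b = (proj₁ (ends e) ≡ a × proj₂ (ends e) ≡ b)
              ⊎ (proj₁ (ends e) ≡ b × proj₂ (ends e) ≡ a)

  IsPerfectMatchingOf : (Fin n → Set) → (Fin m → Set) → (Fin m → Set) → Set
  IsPerfectMatchingOf Vert S N =
    (∀ e → N e → S e) ×
    (∀ v → Vert v →
       Σ (Fin m) λ e → (N e × Incident e v) ×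
         (∀ e' → N e' → Incident e' v → e' ≡ e))

  IsPerfectMatching : EdgeSet → Set
  IsPerfectMatching M =
    IsPerfectMatchingOf (λ _ → ⊤) (λ _ → ⊤) (λ e → M e ≡ true)

  IsEvenCycle : EdgeSet → Set
  IsEvenCycle S =
    Σ ℕ λ k → (3 ≤ k) × (2 ∣ k) ×
    Σ (ℕ → Fin n) λ w →
      (∀ i j → i < k → j < k → w i ≡ w j → i ≡ j) ×
      (w k ≡ w 0) ×
      (∀ i → i < k → Σ (Fin m) λ e → Joins e (w i) (w (suc i))) ×
      (∀ e → (S e ≡ true) ⇔ (∃[ i ] (i < k × Joins e (w i) (w (suc i)))))

-- A graph embedded in a closed surface, recorded through its faces:
-- finitely many faces, each with the set E(f) of edges on its boundary.
record EmbeddedGraph : Set where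
  field
    graph    : Graph
    nfaces   : ℕ
    boundary : Fin nfaces → EdgeSet graph

module Resonance (Γ : EmbeddedGraph) (F : Fin (EmbeddedGraph.nfaces Γ) → Set) where
  open EmbeddedGraph Γ
  open Graph graph

  SymDiffIs : EdgeSet graph → EdgeSet graph → Fin nfaces → Set
  SymDiffIs M₁ M₂ f = ∀ e → (M₁ e xor M₂ e) ≡ boundary f e

  ResAdj : EdgeSet graph → EdgeSet graph → Set
  ResAdj M₁ M₂ = IsPerfectMatching graph M₁ × IsPerfectMatching graph M₂ ×
                 Σ (Fin nfaces) λ f → F f × SymDiffIs M₁ M₂ f

  InComponent : EdgeSet graph → EdgeSet graph → Set
  InComponent M₀ M = Star ResAdj M₀ M

  EdgeGH : EdgeSet graph → Fin m → Set
  EdgeGH M₀ e = Σ (EdgeSet graph) λ M₁ → Σ (EdgeSet graph) λ M₂ →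
                Σ (Fin nfaces) λ f →
                InComponent M₀ M₁ × InComponent M₀ M₂ ×
                F f × SymDiffIs M₁ M₂ f × boundary f e ≡ true

  VertGH : EdgeSet graph → Fin n → Set
  VertGH M₀ v = Σ (Fin m) λ e → EdgeGH M₀ e × Incident graph e v

module Submission where

-- Containment in E(G_H) is built in, so the content is that every vertex v
-- of G_H is covered by an edge of M ∩ E(G_H); uniqueness is inherited from
-- M being a perfect matching of G.  Call a matching N "good at v" if the
-- edge of N covering v lies in G_H.  The argument has three steps:
--   * transfer (pure matching theory): if N and N' are perfect matchings
--     and every edge of N' ∖ N is good, then N good at v ⇒ N' good at v,
--     since the N'-edge at v is either the N-edge at v or lies in N' ∖ N;
--   * along a resonance edge A ~ B of H through face f, both differences
--     A ∖ B and B ∖ A lie in E(f) ⊆ E(G_H), so goodness travels along any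
--     path of H, in either direction (resonance adjacency is symmetric);
--   * every vertex of G_H is witnessed by some matching of H that is good
--     at it, and H is connected, so M is good at every vertex of G_H.

open import Defs
open import Data.Fin using (Fin)
open import Data.Bool using (Bool; true; false; _xor_)
open import Data.Bool.Properties using (xor-comm)
open import Data.Product using (_×_; Σ; _,_; proj₁; proj₂)
open import Data.Unit using (tt)
open import Relation.Binary.PropositionalEquality using (_≡_; refl; sym; trans; subst)
open import Relation.Binary.Construct.Closure.ReflexiveTransitive
  using (Star; ε; _◅_; _◅◅_; reverse)

xor-false-true : ∀ {x y : Bool} → x ≡ false → y ≡ true → (x xor y) ≡ true
xor-false-true refl refl = refl

module Matchings (G : Graph) where
  open Graph G

  CoveredBy : (Fin m → Set) → EdgeSet G → Fin n → Set
  CoveredBy Good N v = Σ (Fin m) λ e → (N e ≡ true) × Incident G e v × Good e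

  matching-edge-unique : ∀ {N} → IsPerfectMatching G N → ∀ {v e e'} →
    N e ≡ true → Incident G e v → N e' ≡ true → Incident G e' v → e ≡ e'
  matching-edge-unique pN {v} {e} {e'} Ne inc Ne' inc' =
    let onlyEdgeAt-v = proj₂ (proj₂ (proj₂ pN v tt)) in
    trans (onlyEdgeAt-v e Ne inc) (sym (onlyEdgeAt-v e' Ne' inc'))

  -- The N'-edge at v either already lies in N,
  -- whence it is the (good) N-edge at v, or it lies in N' ∖ N.
  transfer : ∀ {Good N N'} → IsPerfectMatching G N → IsPerfectMatching G N' →
    (∀ e → N' e ≡ true → N e ≡ false → Good e) →
    ∀ {v} → CoveredBy Good N v → CoveredBy Good N' v
  transfer {Good} {N} pN pN' newGood {v} (e , Ne , inc , good)
    with proj₂ pN' v tt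
  ... | e' , (N'e' , inc') , _ = e' , N'e' , inc' , good' (N e') refl
    where
      good' : (b : Bool) → N e' ≡ b → Good e'
      good' true  Ne' = subst Good (matching-edge-unique pN Ne inc Ne' inc') good
      good' false Ne' = newGood e' N'e' Ne'

  restrict-perfect : ∀ {N} → IsPerfectMatching G N → ∀ {Vert Good} →
    (∀ {v} → Vert v → CoveredBy Good N v) →
    IsPerfectMatchingOf G Vert Good (λ e → (N e ≡ true) × Good e)
  restrict-perfect pN covers = (λ _ → proj₂) , λ v inVert →
    let (e , Ne , inc , good) = covers inVert in
    e , ((Ne , good) , inc) ,
    λ e' (Ne' , _) inc' → matching-edge-unique pN Ne' inc' Ne inc

module Component (Γ : EmbeddedGraph) (F : Fin (EmbeddedGraph.nfaces Γ) → Set)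
                 (M₀ : EdgeSet (EmbeddedGraph.graph Γ)) where
  open EmbeddedGraph Γ
  open Graph graph
  open Resonance Γ F
  open Matchings graph

  GoodAt : EdgeSet graph → Fin n → Set
  GoodAt = CoveredBy (EdgeGH M₀)

  resAdj-sym : ∀ {A B} → ResAdj A B → ResAdj B A
  resAdj-sym {A} {B} (pA , pB , f , Ff , sd) =
    pB , pA , f , Ff , λ e → trans (xor-comm (B e) (A e)) (sd e)

  component-connected : ∀ {A B} → InComponent M₀ A → InComponent M₀ B →
    Star ResAdj A B
  component-connected cA cB = reverse resAdj-sym cA ◅◅ cB

  component-perfect : ∀ {A B} → IsPerfectMatching graph A → Star ResAdj A B →
    IsPerfectMatching graph B
  component-perfect pA ε                    = pA
  component-perfect _  ((_ , pB , _) ◅ path) = component-perfect pB path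

  -- Along an edge A ~ B of H, the new edges B ∖ A lie on the boundary of the
  -- corresponding face, hence in G_H.
  new-edges-in-GH : ∀ {A B} → InComponent M₀ A → (adj : ResAdj A B) →
    ∀ e → B e ≡ true → A e ≡ false → EdgeGH M₀ e
  new-edges-in-GH {A} {B} cA adj@(_ , _ , f , Ff , sd) e Be Ae =
    A , B , f , cA , cA ◅◅ (adj ◅ ε) , Ff , sd ,
    trans (sym (sd e)) (xor-false-true Ae Be)

  good-along-path : ∀ {A B} → InComponent M₀ A → Star ResAdj A B →
    ∀ {v} → GoodAt A v → GoodAt B v
  good-along-path cA ε good = good
  good-along-path cA (adj@(pA , pB , _) ◅ path) good =
    good-along-path (cA ◅◅ (adj ◅ ε)) path
      (transfer pA pB (new-edges-in-GH cA adj) good)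

  -- A vertex v of G_H lies on an edge e of some face f with M₁ ⊕ M₂ = E(f)
  -- for M₁, M₂ in H; e belongs to M₁ or to M₂, which is then good at v.
  vertex-witness : ∀ {v} → VertGH M₀ v →
    Σ (EdgeSet graph) λ N → InComponent M₀ N × GoodAt N v
  vertex-witness {v} (e , inGH@(M₁ , M₂ , f , c₁ , c₂ , _ , sd , onFace) , inc) =
    witness (M₁ e) refl
    where
      witness : (b : Bool) → M₁ e ≡ b →
        Σ (EdgeSet graph) λ N → InComponent M₀ N × GoodAt N v
      witness true  M₁e = M₁ , c₁ , e , M₁e , inc , inGH
      witness false M₁e =
        M₂ , c₂ , e , trans (subst (λ b → (b xor M₂ e) ≡ boundary f e) M₁e (sd e)) onFace ,
        inc , inGH

  good-in-component : ∀ {M} → InComponent M₀ M → ∀ {v} → VertGH M₀ v → GoodAt M v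
  good-in-component cM inGH =
    let (N , cN , goodN) = vertex-witness inGH in
    good-along-path cN (component-connected cN cM) goodN

open Component

proposition5p1 : (Γ : EmbeddedGraph) →
    (F : Fin (EmbeddedGraph.nfaces Γ) → Set) →
    (∀ f → F f → IsEvenCycle (EmbeddedGraph.graph Γ) (EmbeddedGraph.boundary Γ f)) →
    (M₀ M : EdgeSet (EmbeddedGraph.graph Γ)) →
    IsPerfectMatching (EmbeddedGraph.graph Γ) M₀ →
    Resonance.InComponent Γ F M₀ M →
    IsPerfectMatchingOf (EmbeddedGraph.graph Γ)
    (Resonance.VertGH Γ F M₀)
    (Resonance.EdgeGH Γ F M₀)
    (λ e → (M e ≡ true) × Resonance.EdgeGH Γ F M₀ e)
proposition5p1 Γ F _ M₀ M p₀ cM =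
  Matchings.restrict-perfect (EmbeddedGraph.graph Γ)
    (component-perfect Γ F M₀ p₀ cM)
    (good-in-component Γ F M₀ cM)
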